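{- Let $(G_n)_{n\in\mathbb{N}}$ and $(J_n)_{n\in\mathbb{N}}$ be iteratively constructible families of $k$-graphs whose basic operations use distinct labels. Then the family $(G_n\sqcup J_n)_{n\in\mathbb{N}}$ is an iteratively constructible family.
   Context: A $k$-graph is $G=(V,E;R_1,\ldots,R_k)$ with $(V,E)$ a finite simple graph and labels $R_1,\ldots,R_k\subseteq V$ partitioning $V$; the disjoint union of two $k$-graphs is the disjoint union of the graphs, with label class $R_i$ the union of the two $i$-th label classes. Basic operations on $k$-graphs: $Add_i$ (add a new vertex to $R_i$); $\rho_{i\to j}$ (move all vertices of $R_i$ into $R_j$, leaving $R_i$ empty); $\eta_{i,j}$ (add all edges between vertices labeled $i$ and vertices labeled $j$); $\eta^b_{i,j}$ (equal to $\eta_{i,j}$ if $|R_i\cup R_j|\leq b$, otherwise the identity); $\delta_{i,j}$ (remove all edges between vertices labeled $i$ and $j$). An elementary operation is a finite composition of basic operations. An iteratively constructible family of $k$-graphs is a sequence with $G_{n+1}=F(G_n)$ for a fixed $k$-graph $G_0$ and fixed elementary operation $F$. -}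

module Defs where

open import Data.Nat using (ℕ; zero; suc; _+_; _≤_; _≤ᵇ_)
open import Data.Fin using (Fin; zero; suc; splitAt; _≟_)
open import Data.Fin.Properties using ()
open import Data.Bool using (Bool; true; false; _∧_; _∨_; not; if_then_else_)
open import Data.Bool.Properties using (∨-comm; ∧-comm)
open import Data.Sum using (_⊎_; inj₁; inj₂; [_,_])
open import Data.Product using (Σ; ∃; _×_; _,_)
open import Data.List using (List; []; _∷_; _++_; length; filter; concatMap; foldl)
open import Data.List.Membership.Propositional using (_∈_)
open import Data.Vec using (Vec; allFin)
import Data.Vec as Vec
open import Relation.Nullary using (¬_; yes; no)
open import Relation.Nullary.Decidable using (⌊_⌋)
open import Relation.Binary.PropositionalEquality using (_≡_; refl; sym; trans; cong; cong₂)
open import Function.Bundles using (_↔_; Inverse)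
open import Function using (_∘_)

-- k-graphs: a finite simple graph on vertex set Fin size,
-- with a labelling function (the label classes R_1..R_k partition V).

record KGraph (k : ℕ) : Set where
  field
    size       : ℕ
    label      : Fin size → Fin k
    adj        : Fin size → Fin size → Bool
    adj-sym    : ∀ u v → adj u v ≡ adj v u
    adj-irrefl : ∀ u → adj u u ≡ false
open KGraph public

eqb : ∀ {m} → Fin m → Fin m → Bool
eqb u v = ⌊ u ≟ v ⌋

eqb-sym : ∀ {m} (u v : Fin m) → eqb u v ≡ eqb v u
eqb-sym u v with u ≟ v | v ≟ u
... | yes _ | yes _ = refl
... | no _  | no _  = refl
... | yes p | no q  = Data.Empty.⊥-elim (q (sym p)) where import Data.Empty
... | no p  | yes q = Data.Empty.⊥-elim (p (sym q)) where import Data.Empty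

eqb-refl : ∀ {m} (u : Fin m) → eqb u u ≡ true
eqb-refl u with u ≟ u
... | yes _ = refl
... | no p  = Data.Empty.⊥-elim (p refl) where import Data.Empty

isL : ∀ {k} (G : KGraph k) → Fin k → Fin (size G) → Bool
isL G i u = eqb (label G u) i

match : ∀ {k} (G : KGraph k) → Fin k → Fin k → Fin (size G) → Fin (size G) → Bool
match G i j u v = (isL G i u ∧ isL G j v) ∨ (isL G j u ∧ isL G i v)

match-sym : ∀ {k} (G : KGraph k) i j u v → match G i j u v ≡ match G i j v u
match-sym G i j u v =
  trans (∨-comm (isL G i u ∧ isL G j v) (isL G j u ∧ isL G i v))
        (cong₂ _∨_ (∧-comm (isL G j u) (isL G i v)) (∧-comm (isL G i u) (isL G j v)))

addV : ∀ {k} → Fin k → KGraph k → KGraph k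
addV {k} i G = record
  { size = suc (size G) ; label = lab ; adj = a ; adj-sym = s ; adj-irrefl = r }
  where
  lab : Fin (suc (size G)) → Fin k
  lab zero    = i
  lab (suc u) = label G u
  a : Fin (suc (size G)) → Fin (suc (size G)) → Bool
  a zero    _       = false
  a (suc u) zero    = false
  a (suc u) (suc v) = adj G u v
  s : ∀ u v → a u v ≡ a v u
  s zero    zero    = refl
  s zero    (suc v) = refl
  s (suc u) zero    = refl
  s (suc u) (suc v) = adj-sym G u v
  r : ∀ u → a u u ≡ false
  r zero    = refl
  r (suc u) = adj-irrefl G u

relabel : ∀ {k} → Fin k → Fin k → KGraph k → KGraph k
relabel i j G = record
  { size = size G
  ; label = λ u → if isL G i u then j else label G u
  ; adj = adj G ; adj-sym = adj-sym G ; adj-irrefl = adj-irrefl G }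

-- η_{i,j} : add all edges between R_i and R_j (no loops: the graph is simple)
join : ∀ {k} → Fin k → Fin k → KGraph k → KGraph k
join i j G = record
  { size = size G ; label = label G ; adj = a ; adj-sym = s ; adj-irrefl = r }
  where
  a : Fin (size G) → Fin (size G) → Bool
  a u v = adj G u v ∨ (not (eqb u v) ∧ match G i j u v)
  s : ∀ u v → a u v ≡ a v u
  s u v = cong₂ _∨_ (adj-sym G u v)
            (cong₂ _∧_ (cong not (eqb-sym u v)) (match-sym G i j u v))
  r : ∀ u → a u u ≡ false
  r u rewrite adj-irrefl G u | eqb-refl u = refl

unjoin : ∀ {k} → Fin k → Fin k → KGraph k → KGraph k
unjoin i j G = record
  { size = size G ; label = label G ; adj = a ; adj-sym = s ; adj-irrefl = r }
  where
  a : Fin (size G) → Fin (size G) → Bool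
  a u v = adj G u v ∧ not (match G i j u v)
  s : ∀ u v → a u v ≡ a v u
  s u v = cong₂ _∧_ (adj-sym G u v) (cong not (match-sym G i j u v))
  r : ∀ u → a u u ≡ false
  r u rewrite adj-irrefl G u = refl

countIJ : ∀ {k} → Fin k → Fin k → KGraph k → ℕ
countIJ i j G =
  Vec.count (λ u → Relation.Nullary.Decidable.Core.T? (isL G i u ∨ isL G j u)) (allFin (size G))
  where import Relation.Nullary.Decidable.Core

joinB : ∀ {k} → ℕ → Fin k → Fin k → KGraph k → KGraph k
joinB b i j G = if countIJ i j G ≤ᵇ b then join i j G else G

data BasicOp (k : ℕ) : Set where
  Add   : Fin k → BasicOp k
  Rho   : Fin k → Fin k → BasicOp k
  Eta   : Fin k → Fin k → BasicOp k
  EtaB  : ℕ → Fin k → Fin k → BasicOp k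
  Delta : Fin k → Fin k → BasicOp k

applyBasic : ∀ {k} → BasicOp k → KGraph k → KGraph k
applyBasic (Add i)      = addV i
applyBasic (Rho i j)    = relabel i j
applyBasic (Eta i j)    = join i j
applyBasic (EtaB b i j) = joinB b i j
applyBasic (Delta i j)  = unjoin i j

opLabels : ∀ {k} → BasicOp k → List (Fin k)
opLabels (Add i)      = i ∷ []
opLabels (Rho i j)    = i ∷ j ∷ []
opLabels (Eta i j)    = i ∷ j ∷ []
opLabels (EtaB b i j) = i ∷ j ∷ []
opLabels (Delta i j)  = i ∷ j ∷ []

-- An elementary operation: a finite composition of basic operations,
-- given as the list of them in the order they are applied.
Elementary : ℕ → Set
Elementary k = List (BasicOp k)

applyElem : ∀ {k} → Elementary k → KGraph k → KGraph k
applyElem []       G = G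
applyElem (o ∷ os) G = applyElem os (applyBasic o G)

elemLabels : ∀ {k} → Elementary k → List (Fin k)
elemLabels = concatMap opLabels

iterF : ∀ {k} → Elementary k → KGraph k → ℕ → KGraph k
iterF F G0 zero    = G0
iterF F G0 (suc n) = applyElem F (iterF F G0 n)

adjU : ∀ {k} (G J : KGraph k) → Fin (size G) ⊎ Fin (size J) → Fin (size G) ⊎ Fin (size J) → Bool
adjU G J (inj₁ u) (inj₁ v) = adj G u v
adjU G J (inj₂ u) (inj₂ v) = adj J u v
adjU G J (inj₁ u) (inj₂ v) = false
adjU G J (inj₂ u) (inj₁ v) = false

adjU-sym : ∀ {k} (G J : KGraph k) x y → adjU G J x y ≡ adjU G J y x
adjU-sym G J (inj₁ u) (inj₁ v) = adj-sym G u v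
adjU-sym G J (inj₂ u) (inj₂ v) = adj-sym J u v
adjU-sym G J (inj₁ u) (inj₂ v) = refl
adjU-sym G J (inj₂ u) (inj₁ v) = refl

adjU-irrefl : ∀ {k} (G J : KGraph k) x → adjU G J x x ≡ false
adjU-irrefl G J (inj₁ u) = adj-irrefl G u
adjU-irrefl G J (inj₂ u) = adj-irrefl J u

_⊔_ : ∀ {k} → KGraph k → KGraph k → KGraph k
G ⊔ J = record
  { size = size G + size J
  ; label = λ w → [ label G , label J ] (splitAt (size G) w)
  ; adj = λ w w' → adjU G J (splitAt (size G) w) (splitAt (size G) w')
  ; adj-sym = λ w w' → adjU-sym G J (splitAt (size G) w) (splitAt (size G) w')
  ; adj-irrefl = λ w → adjU-irrefl G J (splitAt (size G) w) }

record _≅_ {k : ℕ} (G H : KGraph k) : Set where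
  field
    bij      : Fin (size G) ↔ Fin (size H)
    pres-lab : ∀ u → label H (Inverse.to bij u) ≡ label G u
    pres-adj : ∀ u v → adj H (Inverse.to bij u) (Inverse.to bij v) ≡ adj G u v

IterativelyConstructible : ∀ {k} → (ℕ → KGraph k) → Set
IterativelyConstructible {k} H =
  Σ (KGraph k) λ H0 → Σ (Elementary k) λ F → ∀ n → iterF F H0 n ≅ H n

UsesLabel : ∀ {k} → KGraph k → Elementary k → Fin k → Set
UsesLabel G0 F l = (l ∈ elemLabels F) ⊎ (∃ λ u → label G0 u ≡ l)

-- Two constructions whose label sets are disjoint cannot see each other: every basic
-- operation of F only touches vertices carrying its own labels, so it acts on G ⊔ J
-- exactly as on the G-part (η^b included, since J adds nothing to |R_i ∪ R_j|), and
-- symmetrically for FJ.  Hence applying F and then FJ to G_n ⊔ J_n yields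
-- G_{n+1} ⊔ J_{n+1}, and the union is generated from G_0 ⊔ J_0 by F ++ FJ.
module Submission where

open import Defs
open import Data.Nat using (ℕ; zero; suc; _+_; _≤ᵇ_)
open import Data.Nat.Properties using (+-0-commutativeMonoid; +-assoc; +-identityʳ)
open import Data.Fin using (Fin; zero; suc; splitAt; _≟_)
import Data.Fin as Fin
open import Data.Fin.Properties using (join-splitAt; splitAt-join)
import Data.Fin.Permutation as Perm
open import Data.Bool using (Bool; true; false; _∧_; _∨_; not)
open import Data.Bool.Properties using (∧-zeroʳ; ∧-identityʳ; ∨-identityʳ)
open import Data.Product using (_×_; _,_)
open import Data.Sum using (_⊎_; inj₁; inj₂; [_,_]; swap; map₁)
open import Data.Sum.Properties using (swap-involutive)
open import Data.Empty using (⊥-elim)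
open import Data.List using ([]; _∷_; _++_)
open import Data.List.Membership.Propositional using (_∈_)
open import Data.List.Membership.Propositional.Properties using (∈-++⁺ˡ; ∈-++⁺ʳ)
open import Data.List.Relation.Unary.Any using (here; there)
import Data.Vec as Vec
open import Algebra.Properties.CommutativeMonoid.Sum +-0-commutativeMonoid
  using (sum; sum-permute; sum-cong-≗; sum-replicate-zero)
open import Relation.Nullary using (¬_; yes; no)
open import Relation.Nullary.Decidable.Core using (T?)
open import Level using (0ℓ)
open import Relation.Binary.Bundles using (Setoid)
import Relation.Binary.Reasoning.Setoid as SetoidReasoning
open import Relation.Binary.PropositionalEquality
  using (_≡_; _≢_; refl; sym; trans; cong; cong₂; module ≡-Reasoning)
open import Function using (id; _∘_)
open import Function.Bundles using (Inverse; mk↔ₛ′)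

open _≅_ using (pres-lab; pres-adj)

mk≅ : ∀ {k} {G H : KGraph k}
  (to : Fin (size G) → Fin (size H)) (from : Fin (size H) → Fin (size G))
  → (∀ y → to (from y) ≡ y) → (∀ x → from (to x) ≡ x)
  → (∀ u → label H (to u) ≡ label G u)
  → (∀ u v → adj H (to u) (to v) ≡ adj G u v)
  → G ≅ H
mk≅ to from to-from from-to lab adj′ = record
  { bij = mk↔ₛ′ to from to-from from-to ; pres-lab = lab ; pres-adj = adj′ }

module _ {k} {G H : KGraph k} (φ : G ≅ H) where

  ≅-to : Fin (size G) → Fin (size H)
  ≅-to = Inverse.to (_≅_.bij φ)

  ≅-from : Fin (size H) → Fin (size G)
  ≅-from = Inverse.from (_≅_.bij φ)

  ≅-from-to : ∀ x → ≅-from (≅-to x) ≡ x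
  ≅-from-to x = Perm.inverseˡ (_≅_.bij φ)

  ≅-to-from : ∀ y → ≅-to (≅-from y) ≡ y
  ≅-to-from y = Perm.inverseʳ (_≅_.bij φ)

  ≅-to-injective : ∀ x y → ≅-to x ≡ ≅-to y → x ≡ y
  ≅-to-injective x y e = trans (sym (≅-from-to x)) (trans (cong ≅-from e) (≅-from-to y))

≅-refl : ∀ {k} {G : KGraph k} → G ≅ G
≅-refl = mk≅ id id (λ _ → refl) (λ _ → refl) (λ _ → refl) (λ _ _ → refl)

≅-sym : ∀ {k} {G H : KGraph k} → G ≅ H → H ≅ G
≅-sym {H = H} φ = mk≅ (≅-from φ) (≅-to φ) (≅-from-to φ) (≅-to-from φ)
  (λ u → trans (sym (pres-lab φ (≅-from φ u))) (cong (label H) (≅-to-from φ u)))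
  (λ u v → trans (sym (pres-adj φ (≅-from φ u) (≅-from φ v)))
                 (cong₂ (adj H) (≅-to-from φ u) (≅-to-from φ v)))

≅-trans : ∀ {k} {G H K : KGraph k} → G ≅ H → H ≅ K → G ≅ K
≅-trans φ ψ = mk≅ (λ x → ≅-to ψ (≅-to φ x)) (λ y → ≅-from φ (≅-from ψ y))
  (λ y → trans (cong (≅-to ψ) (≅-to-from φ (≅-from ψ y))) (≅-to-from ψ y))
  (λ x → trans (cong (≅-from φ) (≅-from-to ψ (≅-to φ x))) (≅-from-to φ x))
  (λ u → trans (pres-lab ψ (≅-to φ u)) (pres-lab φ u))
  (λ u v → trans (pres-adj ψ (≅-to φ u) (≅-to φ v)) (pres-adj φ u v))

≅-setoid : ℕ → Setoid 0ℓ 0ℓ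
≅-setoid k = record
  { Carrier = KGraph k ; _≈_ = _≅_
  ; isEquivalence = record { refl = ≅-refl ; sym = ≅-sym ; trans = ≅-trans } }

eqb-false : ∀ {m} {u v : Fin m} → u ≢ v → eqb u v ≡ false
eqb-false {u = u} {v} u≢v with u ≟ v
... | yes u≡v = ⊥-elim (u≢v u≡v)
... | no _    = refl

eqb-injective : ∀ {m n} (f : Fin m → Fin n) → (∀ x y → f x ≡ f y → x ≡ y)
  → ∀ x y → eqb (f x) (f y) ≡ eqb x y
eqb-injective f f-inj x y with x ≟ y
... | yes refl = eqb-refl (f x)
... | no x≢y   = eqb-false (λ e → x≢y (f-inj x y e))

eqb⊎ : ∀ {m n} → Fin m ⊎ Fin n → Fin m ⊎ Fin n → Bool
eqb⊎ (inj₁ u) (inj₁ v) = eqb u v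
eqb⊎ (inj₂ u) (inj₂ v) = eqb u v
eqb⊎ (inj₁ _) (inj₂ _) = false
eqb⊎ (inj₂ _) (inj₁ _) = false

eqb⊎-refl : ∀ {m n} (x : Fin m ⊎ Fin n) → eqb⊎ x x ≡ true
eqb⊎-refl (inj₁ u) = eqb-refl u
eqb⊎-refl (inj₂ u) = eqb-refl u

eqb⊎-false : ∀ {m n} {x y : Fin m ⊎ Fin n} → x ≢ y → eqb⊎ x y ≡ false
eqb⊎-false {x = inj₁ u} {inj₁ v} x≢y = eqb-false (λ e → x≢y (cong inj₁ e))
eqb⊎-false {x = inj₂ u} {inj₂ v} x≢y = eqb-false (λ e → x≢y (cong inj₂ e))
eqb⊎-false {x = inj₁ _} {inj₂ _} _ = refl
eqb⊎-false {x = inj₂ _} {inj₁ _} _ = refl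

eqb-splitAt : ∀ m {n} (w w′ : Fin (m + n)) → eqb w w′ ≡ eqb⊎ (splitAt m w) (splitAt m w′)
eqb-splitAt m {n} w w′ with w ≟ w′
... | yes refl = sym (eqb⊎-refl (splitAt m w))
... | no w≢w′  = sym (eqb⊎-false {x = splitAt m w} λ e → w≢w′ (begin
      w                             ≡⟨ join-splitAt m n w ⟨
      Fin.join m n (splitAt m w)    ≡⟨ cong (Fin.join m n) e ⟩
      Fin.join m n (splitAt m w′)   ≡⟨ join-splitAt m n w′ ⟩
      w′                            ∎))
  where open ≡-Reasoning

indicator : Bool → ℕ
indicator true  = 1
indicator false = 0

countᵇ-tabulate : ∀ {A : Set} n (g : Fin n → A) (p : A → Bool)
  → Vec.count (λ u → T? (p u)) (Vec.tabulate g) ≡ sum (λ x → indicator (p (g x)))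
countᵇ-tabulate zero    g p = refl
countᵇ-tabulate (suc n) g p with p (g zero)
... | true  = cong suc (countᵇ-tabulate n (λ x → g (suc x)) p)
... | false = countᵇ-tabulate n (λ x → g (suc x)) p

sum-splitAt : ∀ m n (g : Fin m ⊎ Fin n → ℕ)
  → sum {m + n} (λ w → g (splitAt m w)) ≡ sum (λ u → g (inj₁ u)) + sum (λ v → g (inj₂ v))
sum-splitAt zero    n g = refl
sum-splitAt (suc m) n g =
  trans (cong (g (inj₁ zero) +_) (sum-splitAt m n (λ x → g (map₁ suc x))))
        (sym (+-assoc (g (inj₁ zero)) _ _))

countIJ≡sum : ∀ {k} (i j : Fin k) (G : KGraph k)
  → countIJ i j G ≡ sum (λ u → indicator (isL G i u ∨ isL G j u))
countIJ≡sum i j G = countᵇ-tabulate (size G) id (λ u → isL G i u ∨ isL G j u)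

countIJ-≅ : ∀ {k} (i j : Fin k) {G H : KGraph k} → G ≅ H → countIJ i j H ≡ countIJ i j G
countIJ-≅ i j {G} {H} φ = begin
  countIJ i j H                                              ≡⟨ countIJ≡sum i j H ⟩
  sum (λ u → indicator (isL H i u ∨ isL H j u))              ≡⟨ sum-permute _ (_≅_.bij φ) ⟩
  sum (λ u → indicator (isL H i (≅-to φ u) ∨ isL H j (≅-to φ u)))
    ≡⟨ sum-cong-≗ (λ u → cong (λ l → indicator (eqb l i ∨ eqb l j)) (pres-lab φ u)) ⟩
  sum (λ u → indicator (isL G i u ∨ isL G j u))              ≡⟨ countIJ≡sum i j G ⟨
  countIJ i j G                                              ∎
  where open ≡-Reasoning

match-≅ : ∀ {k} {G H : KGraph k} (φ : G ≅ H) i j u v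
  → match H i j (≅-to φ u) (≅-to φ v) ≡ match G i j u v
match-≅ φ i j u v rewrite pres-lab φ u | pres-lab φ v = refl

addV-cong : ∀ {k} (i : Fin k) {G H : KGraph k} → G ≅ H → addV i G ≅ addV i H
addV-cong i {G} {H} φ = mk≅ to from to-from from-to lab adj′
  where
  to : Fin (suc (size G)) → Fin (suc (size H))
  to zero    = zero
  to (suc x) = suc (≅-to φ x)
  from : Fin (suc (size H)) → Fin (suc (size G))
  from zero    = zero
  from (suc y) = suc (≅-from φ y)
  to-from : ∀ y → to (from y) ≡ y
  to-from zero    = refl
  to-from (suc y) = cong suc (≅-to-from φ y)
  from-to : ∀ x → from (to x) ≡ x
  from-to zero    = refl
  from-to (suc x) = cong suc (≅-from-to φ x)
  lab : ∀ u → label (addV i H) (to u) ≡ label (addV i G) u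
  lab zero    = refl
  lab (suc u) = pres-lab φ u
  adj′ : ∀ u v → adj (addV i H) (to u) (to v) ≡ adj (addV i G) u v
  adj′ zero    v       = refl
  adj′ (suc u) zero    = refl
  adj′ (suc u) (suc v) = pres-adj φ u v

module _ {k} (i j : Fin k) {G H : KGraph k} (φ : G ≅ H) where

  relabel-cong : relabel i j G ≅ relabel i j H
  relabel-cong = mk≅ (≅-to φ) (≅-from φ) (≅-to-from φ) (≅-from-to φ) lab (pres-adj φ)
    where
    lab : ∀ u → label (relabel i j H) (≅-to φ u) ≡ label (relabel i j G) u
    lab u rewrite pres-lab φ u = refl

  join-cong : join i j G ≅ join i j H
  join-cong = mk≅ (≅-to φ) (≅-from φ) (≅-to-from φ) (≅-from-to φ) (pres-lab φ) adj′
    where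
    adj′ : ∀ u v → adj (join i j H) (≅-to φ u) (≅-to φ v) ≡ adj (join i j G) u v
    adj′ u v rewrite pres-adj φ u v | eqb-injective (≅-to φ) (≅-to-injective φ) u v
                   | match-≅ φ i j u v = refl

  unjoin-cong : unjoin i j G ≅ unjoin i j H
  unjoin-cong = mk≅ (≅-to φ) (≅-from φ) (≅-to-from φ) (≅-from-to φ) (pres-lab φ) adj′
    where
    adj′ : ∀ u v → adj (unjoin i j H) (≅-to φ u) (≅-to φ v) ≡ adj (unjoin i j G) u v
    adj′ u v rewrite pres-adj φ u v | match-≅ φ i j u v = refl

  joinB-cong : ∀ b → joinB b i j G ≅ joinB b i j H
  joinB-cong b with countIJ i j H | countIJ-≅ i j φ
  ... | _ | refl with countIJ i j G ≤ᵇ b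
  ... | true  = join-cong
  ... | false = φ

applyBasic-cong : ∀ {k} (o : BasicOp k) {G H : KGraph k} → G ≅ H → applyBasic o G ≅ applyBasic o H
applyBasic-cong (Add i)      = addV-cong i
applyBasic-cong (Rho i j)    = relabel-cong i j
applyBasic-cong (Eta i j)    = join-cong i j
applyBasic-cong (EtaB b i j) = λ φ → joinB-cong i j φ b
applyBasic-cong (Delta i j)  = unjoin-cong i j

applyElem-cong : ∀ {k} (F : Elementary k) {G H : KGraph k} → G ≅ H → applyElem F G ≅ applyElem F H
applyElem-cong []       φ = φ
applyElem-cong (o ∷ os) φ = applyElem-cong os (applyBasic-cong o φ)

Absent : ∀ {k} → Fin k → KGraph k → Set
Absent l J = ∀ v → label J v ≢ l

isL-absent : ∀ {k} {l : Fin k} (J : KGraph k) → Absent l J → ∀ v → isL J l v ≡ false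
isL-absent J l∉J v = eqb-false (l∉J v)

module _ {k} (G J : KGraph k) where

  addV-⊔ˡ : ∀ i → addV i (G ⊔ J) ≅ (addV i G ⊔ J)
  addV-⊔ˡ i = mk≅ id id (λ _ → refl) (λ _ → refl) lab adj′
    where
    lab : ∀ u → label (addV i G ⊔ J) u ≡ label (addV i (G ⊔ J)) u
    lab zero    = refl
    lab (suc w) with splitAt (size G) w
    ... | inj₁ _ = refl
    ... | inj₂ _ = refl
    adj′ : ∀ u v → adj (addV i G ⊔ J) u v ≡ adj (addV i (G ⊔ J)) u v
    adj′ zero    zero     = refl
    adj′ zero    (suc w′) with splitAt (size G) w′
    ... | inj₁ _ = refl
    ... | inj₂ _ = refl
    adj′ (suc w) zero     with splitAt (size G) w
    ... | inj₁ _ = refl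
    ... | inj₂ _ = refl
    adj′ (suc w) (suc w′) with splitAt (size G) w | splitAt (size G) w′
    ... | inj₁ _ | inj₁ _ = refl
    ... | inj₁ _ | inj₂ _ = refl
    ... | inj₂ _ | inj₁ _ = refl
    ... | inj₂ _ | inj₂ _ = refl

  relabel-⊔ˡ : ∀ {i} j → Absent i J → relabel i j (G ⊔ J) ≅ (relabel i j G ⊔ J)
  relabel-⊔ˡ {i} j i∉J = mk≅ id id (λ _ → refl) (λ _ → refl) lab adj′
    where
    adj′ : ∀ u v → adj (relabel i j G ⊔ J) u v ≡ adj (relabel i j (G ⊔ J)) u v
    adj′ w w′ with splitAt (size G) w | splitAt (size G) w′
    ... | inj₁ _ | inj₁ _ = refl
    ... | inj₁ _ | inj₂ _ = refl
    ... | inj₂ _ | inj₁ _ = refl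
    ... | inj₂ _ | inj₂ _ = refl
    lab : ∀ u → label (relabel i j G ⊔ J) u ≡ label (relabel i j (G ⊔ J)) u
    lab w with splitAt (size G) w
    ... | inj₁ _ = refl
    ... | inj₂ v rewrite isL-absent J i∉J v = refl

  join-⊔ˡ : ∀ {i j} → Absent i J → Absent j J → join i j (G ⊔ J) ≅ (join i j G ⊔ J)
  join-⊔ˡ {i} {j} i∉J j∉J = mk≅ id id (λ _ → refl) (λ _ → refl) (λ _ → refl) adj′
    where
    adj′ : ∀ u v → adj (join i j G ⊔ J) u v ≡ adj (join i j (G ⊔ J)) u v
    adj′ w w′ rewrite eqb-splitAt (size G) w w′ with splitAt (size G) w | splitAt (size G) w′
    ... | inj₁ _ | inj₁ _ = refl
    ... | inj₁ u | inj₂ v′ rewrite isL-absent J i∉J v′ | isL-absent J j∉J v′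
                                 | ∧-zeroʳ (isL G i u) | ∧-zeroʳ (isL G j u) = refl
    ... | inj₂ v | inj₁ _  rewrite isL-absent J i∉J v | isL-absent J j∉J v = refl
    ... | inj₂ v | inj₂ v′ rewrite isL-absent J i∉J v | isL-absent J j∉J v
                                 | ∧-zeroʳ (not (eqb v v′)) | ∨-identityʳ (adj J v v′) = refl

  unjoin-⊔ˡ : ∀ {i j} → Absent i J → Absent j J → unjoin i j (G ⊔ J) ≅ (unjoin i j G ⊔ J)
  unjoin-⊔ˡ {i} {j} i∉J j∉J = mk≅ id id (λ _ → refl) (λ _ → refl) (λ _ → refl) adj′
    where
    adj′ : ∀ u v → adj (unjoin i j G ⊔ J) u v ≡ adj (unjoin i j (G ⊔ J)) u v
    adj′ w w′ with splitAt (size G) w | splitAt (size G) w′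
    ... | inj₁ _ | inj₁ _ = refl
    ... | inj₁ _ | inj₂ _ = refl
    ... | inj₂ _ | inj₁ _ = refl
    ... | inj₂ v | inj₂ v′ rewrite isL-absent J i∉J v | isL-absent J j∉J v
                                 | ∧-identityʳ (adj J v v′) = refl

  countIJ-⊔ˡ : ∀ {i j} → Absent i J → Absent j J → countIJ i j (G ⊔ J) ≡ countIJ i j G
  countIJ-⊔ˡ {i} {j} i∉J j∉J = begin
    countIJ i j (G ⊔ J)                         ≡⟨ countIJ≡sum i j (G ⊔ J) ⟩
    sum (λ w → counted (splitAt (size G) w))    ≡⟨ sum-splitAt (size G) (size J) counted ⟩
    sum (counted ∘ inj₁) + sum (counted ∘ inj₂) ≡⟨ cong (sum (counted ∘ inj₁) +_) J-uncounted ⟩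
    sum (counted ∘ inj₁) + 0                    ≡⟨ +-identityʳ _ ⟩
    sum (counted ∘ inj₁)                        ≡⟨ countIJ≡sum i j G ⟨
    countIJ i j G                               ∎
    where
    open ≡-Reasoning
    counted : Fin (size G) ⊎ Fin (size J) → ℕ
    counted x = indicator (eqb ([ label G , label J ] x) i ∨ eqb ([ label G , label J ] x) j)
    J-uncounted : sum (counted ∘ inj₂) ≡ 0
    J-uncounted = trans
      (sum-cong-≗ λ v →
        cong₂ (λ a b → indicator (a ∨ b)) (isL-absent J i∉J v) (isL-absent J j∉J v))
      (sum-replicate-zero (size J))

  joinB-⊔ˡ : ∀ b {i j} → Absent i J → Absent j J → joinB b i j (G ⊔ J) ≅ (joinB b i j G ⊔ J)
  joinB-⊔ˡ b {i} {j} i∉J j∉J with countIJ i j (G ⊔ J) | countIJ-⊔ˡ i∉J j∉J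
  ... | _ | refl with countIJ i j G ≤ᵇ b
  ... | true  = join-⊔ˡ i∉J j∉J
  ... | false = ≅-refl

  applyBasic-⊔ˡ : ∀ o → (∀ l → l ∈ opLabels o → Absent l J)
    → applyBasic o (G ⊔ J) ≅ (applyBasic o G ⊔ J)
  applyBasic-⊔ˡ (Add i)      _   = addV-⊔ˡ i
  applyBasic-⊔ˡ (Rho i j)    o∉J = relabel-⊔ˡ j (o∉J i (here refl))
  applyBasic-⊔ˡ (Eta i j)    o∉J = join-⊔ˡ (o∉J i (here refl)) (o∉J j (there (here refl)))
  applyBasic-⊔ˡ (EtaB b i j) o∉J = joinB-⊔ˡ b (o∉J i (here refl)) (o∉J j (there (here refl)))
  applyBasic-⊔ˡ (Delta i j)  o∉J = unjoin-⊔ˡ (o∉J i (here refl)) (o∉J j (there (here refl)))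

⊔-comm : ∀ {k} (G J : KGraph k) → (G ⊔ J) ≅ (J ⊔ G)
⊔-comm G J = mk≅ (flip G J) (flip J G) (flip-flip J G) (flip-flip G J) lab adj′
  where
  flip : ∀ {k} (G J : KGraph k) → Fin (size G + size J) → Fin (size J + size G)
  flip G J w = Fin.join (size J) (size G) (swap (splitAt (size G) w))
  splitAt-flip : ∀ {k} (G J : KGraph k) w → splitAt (size J) (flip G J w) ≡ swap (splitAt (size G) w)
  splitAt-flip G J w = splitAt-join (size J) (size G) (swap (splitAt (size G) w))
  flip-flip : ∀ {k} (G J : KGraph k) w → flip J G (flip G J w) ≡ w
  flip-flip G J w rewrite splitAt-flip G J w | swap-involutive (splitAt (size G) w) =
    join-splitAt (size G) (size J) w
  lab : ∀ u → label (J ⊔ G) (flip G J u) ≡ label (G ⊔ J) u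
  lab w rewrite splitAt-flip G J w with splitAt (size G) w
  ... | inj₁ _ = refl
  ... | inj₂ _ = refl
  adj′ : ∀ u v → adj (J ⊔ G) (flip G J u) (flip G J v) ≡ adj (G ⊔ J) u v
  adj′ w w′ rewrite splitAt-flip G J w | splitAt-flip G J w′
    with splitAt (size G) w | splitAt (size G) w′
  ... | inj₁ _ | inj₁ _ = refl
  ... | inj₁ _ | inj₂ _ = refl
  ... | inj₂ _ | inj₁ _ = refl
  ... | inj₂ _ | inj₂ _ = refl

applyBasic-⊔ʳ : ∀ {k} (G J : KGraph k) o → (∀ l → l ∈ opLabels o → Absent l G)
  → applyBasic o (G ⊔ J) ≅ (G ⊔ applyBasic o J)
applyBasic-⊔ʳ G J o o∉G = ≅-trans (applyBasic-cong o (⊔-comm G J))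
  (≅-trans (applyBasic-⊔ˡ J G o o∉G) (⊔-comm (applyBasic o J) G))

applyElem-⊔ˡ : ∀ {k} (F : Elementary k) (G J : KGraph k)
  → (∀ l → l ∈ elemLabels F → Absent l J)
  → applyElem F (G ⊔ J) ≅ (applyElem F G ⊔ J)
applyElem-⊔ˡ []       G J _   = ≅-refl
applyElem-⊔ˡ (o ∷ os) G J F∉J = ≅-trans
  (applyElem-cong os (applyBasic-⊔ˡ G J o λ l m → F∉J l (∈-++⁺ˡ m)))
  (applyElem-⊔ˡ os (applyBasic o G) J λ l m → F∉J l (∈-++⁺ʳ (opLabels o) m))

applyElem-⊔ʳ : ∀ {k} (F : Elementary k) (G J : KGraph k)
  → (∀ l → l ∈ elemLabels F → Absent l G)
  → applyElem F (G ⊔ J) ≅ (G ⊔ applyElem F J)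
applyElem-⊔ʳ []       G J _   = ≅-refl
applyElem-⊔ʳ (o ∷ os) G J F∉G = ≅-trans
  (applyElem-cong os (applyBasic-⊔ʳ G J o λ l m → F∉G l (∈-++⁺ˡ m)))
  (applyElem-⊔ʳ os G (applyBasic o J) λ l m → F∉G l (∈-++⁺ʳ (opLabels o) m))

applyBasic-labels : ∀ {k} (P : Fin k → Set) (o : BasicOp k) (G : KGraph k)
  → (∀ l → l ∈ opLabels o → P l) → (∀ u → P (label G u))
  → ∀ u → P (label (applyBasic o G) u)
applyBasic-labels P (Add i)      G o⊆P G⊆P zero    = o⊆P i (here refl)
applyBasic-labels P (Add i)      G o⊆P G⊆P (suc u) = G⊆P u
applyBasic-labels P (Rho i j)    G o⊆P G⊆P u with isL G i u
... | true  = o⊆P j (there (here refl))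
... | false = G⊆P u
applyBasic-labels P (Eta i j)    G o⊆P G⊆P u = G⊆P u
applyBasic-labels P (EtaB b i j) G o⊆P G⊆P u with countIJ i j G ≤ᵇ b
... | true  = G⊆P u
... | false = G⊆P u
applyBasic-labels P (Delta i j)  G o⊆P G⊆P u = G⊆P u

applyElem-labels : ∀ {k} (P : Fin k → Set) (F : Elementary k) (G : KGraph k)
  → (∀ l → l ∈ elemLabels F → P l) → (∀ u → P (label G u))
  → ∀ u → P (label (applyElem F G) u)
applyElem-labels P []       G F⊆P G⊆P = G⊆P
applyElem-labels P (o ∷ os) G F⊆P G⊆P =
  applyElem-labels P os (applyBasic o G) (λ l m → F⊆P l (∈-++⁺ʳ (opLabels o) m))
    (applyBasic-labels P o G (λ l m → F⊆P l (∈-++⁺ˡ m)) G⊆P)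

iterF-labels : ∀ {k} (G0 : KGraph k) (F : Elementary k) n u → UsesLabel G0 F (label (iterF F G0 n) u)
iterF-labels G0 F zero    u = inj₂ (u , refl)
iterF-labels G0 F (suc n)   =
  applyElem-labels (UsesLabel G0 F) F (iterF F G0 n) (λ _ → inj₁) (iterF-labels G0 F n)

iterF-absent : ∀ {k} (G0 : KGraph k) (F : Elementary k) {l} → ¬ UsesLabel G0 F l
  → ∀ n → Absent l (iterF F G0 n)
iterF-absent G0 F unused n u refl = unused (iterF-labels G0 F n u)

applyElem-++ : ∀ {k} (F F′ : Elementary k) G
  → applyElem (F ++ F′) G ≡ applyElem F′ (applyElem F G)
applyElem-++ []       F′ G = refl
applyElem-++ (o ∷ os) F′ G = applyElem-++ os F′ (applyBasic o G)

lemma5p8 : (k : ℕ) (G0 J0 : KGraph k) (F FJ : Elementary k)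
           → (∀ (l : Fin k) → ¬ (UsesLabel G0 F l × UsesLabel J0 FJ l))
           → IterativelyConstructible (λ n → iterF F G0 n ⊔ iterF FJ J0 n)
lemma5p8 k G0 J0 F FJ disjoint = G0 ⊔ J0 , F ++ FJ , union≅
  where
  open SetoidReasoning (≅-setoid k)
  G : ℕ → KGraph k
  G = iterF F G0
  J : ℕ → KGraph k
  J = iterF FJ J0
  F∉J : ∀ n l → l ∈ elemLabels F → Absent l (J n)
  F∉J n l l∈F = iterF-absent J0 FJ (λ l∈J → disjoint l (inj₁ l∈F , l∈J)) n
  FJ∉G : ∀ n l → l ∈ elemLabels FJ → Absent l (G n)
  FJ∉G n l l∈FJ = iterF-absent G0 F (λ l∈G → disjoint l (l∈G , inj₁ l∈FJ)) n
  union≅ : ∀ n → iterF (F ++ FJ) (G0 ⊔ J0) n ≅ (G n ⊔ J n)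
  union≅ zero    = ≅-refl
  union≅ (suc n) = begin
    applyElem (F ++ FJ) (iterF (F ++ FJ) (G0 ⊔ J0) n)
      ≡⟨ applyElem-++ F FJ _ ⟩
    applyElem FJ (applyElem F (iterF (F ++ FJ) (G0 ⊔ J0) n))
      ≈⟨ applyElem-cong FJ (applyElem-cong F (union≅ n)) ⟩
    applyElem FJ (applyElem F (G n ⊔ J n))
      ≈⟨ applyElem-cong FJ (applyElem-⊔ˡ F (G n) (J n) (F∉J n)) ⟩
    applyElem FJ (G (suc n) ⊔ J n)
      ≈⟨ applyElem-⊔ʳ FJ (G (suc n)) (J n) (FJ∉G (suc n)) ⟩
    G (suc n) ⊔ J (suc n)
      ∎
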